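{- There is an absolute constant $C$ such that for every string $T$ (as in the context) with run-length encoding size $m$, $\mathcal{X}\le C\,m$; i.e. $\mathcal{X}\in O(m)$.
   Context: $\Sigma$ is an ordered alphabet, $\$\notin\Sigma$, and $T$ is a string of length $n\ge3$ with $T[1]=T[n]=\$$ and $T[2..n-1]\in\Sigma^*$; $m$ is the number of maximal runs of equal characters in $T[2..n-1]$. For a string $w$, $R(w)$ is the number of maximal runs of equal characters in $w$. A string $w\in(\Sigma\cup\{\$\})^*$ with $|w|\ge2$ is a bridge if $w[1]\neq w[2]$ and $w[|w|-1]\neq w[|w|]$; $\mathcal{B}$ is the set of bridges that are substrings of $T$, and $B_\ell=\{w\in\mathcal{B}\mid R(w)=\ell\}$. For a string $w$ with $R(w)\ge3$, $w^{(1)}$ is obtained from $w$ by deleting its first and last runs and then shortening the new first and last runs to length 1; $w^{(1)}=\varepsilon$ if $R(w)\le2$. $K(w)=\{w'\in\mathcal{B}\mid w'^{(1)}=w\}$. $\mathcal{W}$ is the set of bridges $w$ with $|K(w)|\ge2$ or $w\in B_2\cup B_3$, and $\mathcal{X}=\sum_{w\in\mathcal{W}}|K(w)|$. -}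

module Defs where

open import Data.Nat using (ℕ; zero; suc; _≤_; _≤?_)
open import Data.Nat.Properties using () renaming (_≟_ to _≟ℕ_)
open import Data.Product using (_×_; _,_)
open import Data.Sum using (_⊎_)
open import Data.Empty using (⊥)
open import Data.Maybe using (Maybe; nothing; just)
import Data.Maybe.Properties as MaybeP
open import Data.List using (List; []; _∷_; _++_; length; map; replicate; concatMap; inits; tails; filter; deduplicate; drop)
import Data.List.Properties as ListP
open import Data.List.Membership.Propositional using (_∈_)
open import Relation.Binary.PropositionalEquality using (_≡_; _≢_)
open import Relation.Binary.Definitions using (DecidableEquality)
open import Relation.Nullary using (Dec; yes; no; ¬_)
open import Relation.Nullary.Decidable using (_×-dec_; ¬?)

module Strings {X : Set} (_≟_ : DecidableEquality X) where

  rle : List X → List (X × ℕ)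
  rle [] = []
  rle (x ∷ xs) with rle xs
  ... | [] = (x , 1) ∷ []
  ... | (y , k) ∷ rs with x ≟ y
  ...   | yes _ = (y , suc k) ∷ rs
  ...   | no _  = (x , 1) ∷ (y , k) ∷ rs

  unrle : List (X × ℕ) → List X
  unrle [] = []
  unrle ((x , k) ∷ rs) = replicate k x ++ unrle rs

  R : List X → ℕ
  R w = length (rle w)

  dropLast : {Y : Set} → List Y → List Y
  dropLast [] = []
  dropLast (y ∷ []) = []
  dropLast (y ∷ z ∷ ys) = y ∷ dropLast (z ∷ ys)

  shortenLast : List (X × ℕ) → List (X × ℕ)
  shortenLast [] = []
  shortenLast ((x , _) ∷ []) = (x , 1) ∷ []
  shortenLast (r ∷ s ∷ rs) = r ∷ shortenLast (s ∷ rs)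

  shortenEnds : List (X × ℕ) → List (X × ℕ)
  shortenEnds [] = []
  shortenEnds ((x , _) ∷ rs) = shortenLast ((x , 1) ∷ rs)

  w⁽¹⁾ : List X → List X
  w⁽¹⁾ w with 3 ≤? R w
  ... | yes _ = unrle (shortenEnds (dropLast (drop 1 (rle w))))
  ... | no _  = []

  FirstTwoDiffer : List X → Set
  FirstTwoDiffer (x ∷ y ∷ _) = x ≢ y
  FirstTwoDiffer _ = ⊥

  LastTwoDiffer : List X → Set
  LastTwoDiffer (x ∷ y ∷ []) = x ≢ y
  LastTwoDiffer (x ∷ y ∷ z ∷ zs) = LastTwoDiffer (y ∷ z ∷ zs)
  LastTwoDiffer _ = ⊥

  firstTwoDiffer? : (w : List X) → Dec (FirstTwoDiffer w)
  firstTwoDiffer? [] = no λ ()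
  firstTwoDiffer? (x ∷ []) = no λ ()
  firstTwoDiffer? (x ∷ y ∷ _) = ¬? (x ≟ y)

  lastTwoDiffer? : (w : List X) → Dec (LastTwoDiffer w)
  lastTwoDiffer? [] = no λ ()
  lastTwoDiffer? (x ∷ []) = no λ ()
  lastTwoDiffer? (x ∷ y ∷ []) = ¬? (x ≟ y)
  lastTwoDiffer? (x ∷ y ∷ z ∷ zs) = lastTwoDiffer? (y ∷ z ∷ zs)

  IsBridge : List X → Set
  IsBridge w = 2 ≤ length w × FirstTwoDiffer w × LastTwoDiffer w

  isBridge? : (w : List X) → Dec (IsBridge w)
  isBridge? w = (2 ≤? length w) ×-dec (firstTwoDiffer? w ×-dec lastTwoDiffer? w)

  _≟ˡ_ : DecidableEquality (List X)
  _≟ˡ_ = ListP.≡-dec _≟_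

  substrings : List X → List (List X)
  substrings t = concatMap inits (tails t)

  ℬ : List X → List (List X)
  ℬ t = deduplicate _≟ˡ_ (filter isBridge? (substrings t))

  K : List X → List X → List (List X)
  K t w = filter (λ w' → w⁽¹⁾ w' ≟ˡ w) (ℬ t)

  In𝒲 : List X → List X → Set
  In𝒲 t w = IsBridge w × (2 ≤ length (K t w) ⊎ (w ∈ ℬ t × (R w ≡ 2 ⊎ R w ≡ 3)))

-- The text T = $ S $ over Σ ∪ {$}, with Σ ∪ {$} encoded as Maybe Σ
-- and $ = nothing.

$T$ : {A : Set} → List A → List (Maybe A)
$T$ S = nothing ∷ (map just S ++ nothing ∷ [])

module Text {A : Set} (_≟_ : DecidableEquality A) (S : List A) where
  private
    module Σ$ = Strings (MaybeP.≡-dec _≟_)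
    module Σ  = Strings _≟_

  T : List (Maybe A)
  T = $T$ S

  -- m: number of maximal runs of T[2..n-1] = S
  m : ℕ
  m = Σ.R S

  K : List (Maybe A) → List (List (Maybe A))
  K = Σ$.K T

  In𝒲 : List (Maybe A) → Set
  In𝒲 = Σ$.In𝒲 T

module Submission where

-- Let U = ℬ be the bridges of T and φ = w⁽¹⁾, so that K(w) is the fibre of φ over w.
-- For w ∈ 𝒲 either |K(w)| ≥ 2 or w ∈ B₂ ∪ B₃, so |K(w)| ≤ 2(|K(w)| − 1) + [w ∈ B₂ ∪ B₃].
-- The excesses |K(w)| − 1 add up to at most the number of bridges outside the image of φ.
-- A bridge x⋯y whose first and last characters are not $ lies in that image: extending it
-- on the left by the rest of the run of x and one more character, and symmetrically on the
-- right, gives a bridge b′ with b′⁽¹⁾ = x⋯y.  So only the bridges beginning or ending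
-- with $, i.e. prefixes and suffixes of T, escape the image.  These, and the bridges in
-- B₂ ∪ B₃, are each determined by one of the at most m + 1 positions where T changes
-- character, at most two per position.  Hence 𝒳 ≤ 6(m + 1) ≤ 12m.

open import Defs
open import Level using (0ℓ)
open import Function using (_∘_)
open import Data.Nat using (ℕ; zero; suc; _+_; _*_; _∸_; _≤_; _≤?_; z≤n; s≤s)
open import Data.Nat.Properties
open import Data.Nat.Properties using () renaming (_≟_ to _≟ℕ_)
open import Algebra.Properties.CommutativeSemigroup +-commutativeSemigroup using (interchange; x∙yz≈y∙xz)
open import Data.Nat.ListAction using (sum)
open import Data.Product using (Σ; _×_; _,_; proj₁; proj₂)
open import Data.Sum using (_⊎_; inj₁; inj₂)
open import Data.Empty using (⊥-elim)
open import Data.Maybe using (Maybe; nothing; just)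
import Data.Maybe.Properties as Maybe
open import Data.List
  using (List; []; _∷_; initLast; _∷ʳ′_; _++_; length; map; filter; deduplicate; replicate; drop; take; head; last; inits; tails)
open import Data.List.Properties
  using (∷-injective; ++-identityʳ; ++-conicalˡ; ++-conicalʳ; ++-assoc; length-++-≤ʳ; length-++; length-map; filter-none)
open import Data.List.Membership.Propositional using (_∈_)
open import Data.List.Membership.Propositional.Properties
  using (∈-map⁺; ∈-map⁻; ∈-filter⁺; ∈-filter⁻; ∈-deduplicate⁺; ∈-deduplicate⁻; ∈-++⁺ˡ; ∈-++⁺ʳ; ∈-++⁻)
open import Data.List.Relation.Binary.Subset.Propositional using (_⊆_)
import Data.List.Relation.Unary.All as All
open import Data.List.Relation.Unary.Any using (here; there)
open import Data.List.Relation.Unary.Unique.Propositional using (Unique; []; _∷_)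
import Data.List.Relation.Unary.Unique.Propositional.Properties as Unique
open import Data.List.Relation.Unary.Unique.DecPropositional.Properties using (deduplicate-!)
open import Relation.Binary.Core using (Rel)
open import Relation.Binary.Definitions using (DecidableEquality)
open import Relation.Binary.Structures using (IsStrictTotalOrder)
open import Relation.Binary.PropositionalEquality
open import Relation.Nullary using (Dec; yes; no; ¬_)
open import Relation.Nullary.Decidable using (_×-dec_; _⊎-dec_)
open import Relation.Unary using (Pred; Decidable)
open import Relation.Unary.Properties using (∁?)

∑ : {Y : Set} → (Y → ℕ) → List Y → ℕ
∑ f xs = sum (map f xs)

𝟙 : {P : Set} → Dec P → ℕ
𝟙 (yes _) = 1
𝟙 (no _)  = 0

module _ {Y : Set} where

  ∑-cong-∈ : {f g : Y → ℕ} (xs : List Y) → (∀ {x} → x ∈ xs → f x ≡ g x) → ∑ f xs ≡ ∑ g xs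
  ∑-cong-∈ []       eq = refl
  ∑-cong-∈ (x ∷ xs) eq = cong₂ _+_ (eq (here refl)) (∑-cong-∈ xs (eq ∘ there))

  ∑-mono-∈ : {f g : Y → ℕ} (xs : List Y) → (∀ {x} → x ∈ xs → f x ≤ g x) → ∑ f xs ≤ ∑ g xs
  ∑-mono-∈ []       le = z≤n
  ∑-mono-∈ (x ∷ xs) le = +-mono-≤ (le (here refl)) (∑-mono-∈ xs (le ∘ there))

  ∑-+ : (f g : Y → ℕ) (xs : List Y) → ∑ (λ x → f x + g x) xs ≡ ∑ f xs + ∑ g xs
  ∑-+ f g []       = refl
  ∑-+ f g (x ∷ xs) = trans (cong (f x + g x +_) (∑-+ f g xs)) (interchange (f x) (g x) (∑ f xs) (∑ g xs))

  ∑-*ˡ : (c : ℕ) (f : Y → ℕ) (xs : List Y) → ∑ (λ x → c * f x) xs ≡ c * ∑ f xs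
  ∑-*ˡ c f []       = sym (*-zeroʳ c)
  ∑-*ˡ c f (x ∷ xs) = trans (cong (c * f x +_) (∑-*ˡ c f xs)) (sym (*-distribˡ-+ c (f x) (∑ f xs)))

  ∑-zero : (xs : List Y) → ∑ (λ _ → 0) xs ≡ 0
  ∑-zero []       = refl
  ∑-zero (_ ∷ xs) = ∑-zero xs

  ∑-one : (xs : List Y) → ∑ (λ _ → 1) xs ≡ length xs
  ∑-one []       = refl
  ∑-one (_ ∷ xs) = cong suc (∑-one xs)

  module _ {P : Pred Y 0ℓ} (P? : Decidable P) where

    ∑-𝟙 : (xs : List Y) → ∑ (λ x → 𝟙 (P? x)) xs ≡ length (filter P? xs)
    ∑-𝟙 []       = refl
    ∑-𝟙 (x ∷ xs) with P? x
    ... | yes _ = cong suc (∑-𝟙 xs)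
    ... | no _  = ∑-𝟙 xs

    length-filter-∁ : (xs : List Y) → length xs ≡ length (filter P? xs) + length (filter (∁? P?) xs)
    length-filter-∁ []       = refl
    length-filter-∁ (x ∷ xs) with P? x
    ... | yes _ = cong suc (length-filter-∁ xs)
    ... | no _  = trans (cong suc (length-filter-∁ xs)) (sym (+-suc _ _))

++-∷ʳ-++ : {B : Set} (P xs : List B) (x : B) (Q : List B) → P ++ (xs ++ x ∷ []) ++ Q ≡ (P ++ xs) ++ x ∷ Q
++-∷ʳ-++ P xs x Q = trans (cong (P ++_) (++-assoc xs (x ∷ []) Q)) (sym (++-assoc P xs (x ∷ Q)))

length-++-twice : {B : Set} (xs ys : List B) {n : ℕ} → length xs ≡ n → length ys ≡ n → length (xs ++ ys) ≡ 2 * n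
length-++-twice xs ys {n} refl ys≡n = trans (length-++ xs) (cong (length xs +_) (trans ys≡n (sym (+-identityʳ n))))

n≤2[n∸1]+1 : (n : ℕ) → n ≤ 2 * (n ∸ 1) + 1
n≤2[n∸1]+1 zero    = z≤n
n≤2[n∸1]+1 (suc k) = subst (suc k ≤_) (+-comm 1 (2 * k)) (s≤s (m≤m+n k (k + 0)))

n≤2[n∸1] : (n : ℕ) → 2 ≤ n → n ≤ 2 * (n ∸ 1)
n≤2[n∸1] (suc zero)    (s≤s ())
n≤2[n∸1] (suc (suc k)) _ = s≤s (subst (suc k ≤_) (sym (+-suc k (k + 0))) (s≤s (m≤m+n k (k + 0))))

module WithDecidableEquality {Y : Set} (_≟_ : DecidableEquality Y) where

  remove : Y → List Y → List Y
  remove a [] = []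
  remove a (x ∷ xs) with a ≟ x
  ... | yes _ = xs
  ... | no _  = x ∷ remove a xs

  ∑-remove : (f : Y → ℕ) {a : Y} (xs : List Y) → a ∈ xs → ∑ f xs ≡ f a + ∑ f (remove a xs)
  ∑-remove f {a} (x ∷ xs) a∈ with a ≟ x
  ∑-remove f {a} (x ∷ xs) a∈          | yes refl = refl
  ∑-remove f {a} (x ∷ xs) (here a≡x)  | no a≢x   = ⊥-elim (a≢x a≡x)
  ∑-remove f {a} (x ∷ xs) (there a∈)  | no _     = begin
    f x + ∑ f xs                        ≡⟨ cong (f x +_) (∑-remove f xs a∈) ⟩
    f x + (f a + ∑ f (remove a xs))     ≡⟨ x∙yz≈y∙xz (f x) (f a) _ ⟩
    f a + (f x + ∑ f (remove a xs))     ∎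
    where open ≡-Reasoning

  ∈-remove : {a x : Y} (xs : List Y) → x ∈ xs → a ≢ x → x ∈ remove a xs
  ∈-remove {a} (y ∷ ys) x∈ a≢x with a ≟ y | x∈
  ... | yes refl | here refl = ⊥-elim (a≢x refl)
  ... | yes refl | there x∈ys = x∈ys
  ... | no _     | here refl = here refl
  ... | no _     | there x∈ys = there (∈-remove ys x∈ys a≢x)

  ∑-mono-support : (f : Y → ℕ) {xs : List Y} (ys : List Y) → Unique xs →
                   (∀ {x} → x ∈ xs → f x ≡ 0 ⊎ x ∈ ys) → ∑ f xs ≤ ∑ f ys
  ∑-mono-support f ys [] support = z≤n
  ∑-mono-support f {a ∷ xs} ys (a∉xs ∷ uxs) support with support (here refl)
  ... | inj₁ fa≡0 rewrite fa≡0 = ∑-mono-support f ys uxs (support ∘ there)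
  ... | inj₂ a∈ys = begin
    f a + ∑ f xs               ≤⟨ +-monoʳ-≤ (f a) (∑-mono-support f (remove a ys) uxs support′) ⟩
    f a + ∑ f (remove a ys)    ≡⟨ ∑-remove f ys a∈ys ⟨
    ∑ f ys                     ∎
    where
    open ≤-Reasoning
    support′ : ∀ {x} → x ∈ xs → f x ≡ 0 ⊎ x ∈ remove a ys
    support′ x∈ with support (there x∈)
    ... | inj₁ fx≡0 = inj₁ fx≡0
    ... | inj₂ x∈ys = inj₂ (∈-remove ys x∈ys (All.lookup a∉xs x∈))

  length-mono-⊆ : {xs ys : List Y} → Unique xs → xs ⊆ ys → length xs ≤ length ys
  length-mono-⊆ {xs} {ys} uxs xs⊆ys =
    subst₂ _≤_ (∑-one xs) (∑-one ys) (∑-mono-support (λ _ → 1) ys uxs (inj₂ ∘ xs⊆ys))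

  ∑-𝟙-≟ : {a : Y} (xs : List Y) → Unique xs → a ∈ xs → ∑ (λ x → 𝟙 (a ≟ x)) xs ≡ 1
  ∑-𝟙-≟ {a} (x ∷ xs) (x∉xs ∷ uxs) a∈ with a ≟ x | a∈
  ... | yes refl | _          = cong suc (trans (∑-𝟙 (a ≟_) xs) (cong length (filter-none (a ≟_) x∉xs)))
  ... | no a≢x   | here a≡x   = ⊥-elim (a≢x a≡x)
  ... | no _     | there a∈xs = ∑-𝟙-≟ xs uxs a∈xs

module Fibres {Y : Set} (_≟_ : DecidableEquality Y) (φ : Y → Y) where
  open WithDecidableEquality _≟_

  fibre : List Y → Y → List Y
  fibre U w = filter (λ b → φ b ≟ w) U

  excess : List Y → Y → ℕ
  excess U w = length (fibre U w) ∸ 1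

  image : List Y → List Y
  image U = deduplicate _≟_ (map φ U)

  image-! : (U : List Y) → Unique (image U)
  image-! U = deduplicate-! _≟_ (map φ U)

  ∈-image⁺ : {U : List Y} {b : Y} → b ∈ U → φ b ∈ image U
  ∈-image⁺ b∈U = ∈-deduplicate⁺ _≟_ (∈-map⁺ φ b∈U)

  ∑-length-fibre : {V : List Y} → Unique V → (U : List Y) → (∀ {b} → b ∈ U → φ b ∈ V) →
                   ∑ (length ∘ fibre U) V ≡ length U
  ∑-length-fibre {V} uV [] _ = ∑-zero V
  ∑-length-fibre {V} uV (b ∷ U) φU⊆V = begin
    ∑ (length ∘ fibre (b ∷ U)) V                          ≡⟨ ∑-cong-∈ V (λ {w} _ → fibre-∷ w) ⟩
    ∑ (λ w → 𝟙 (φ b ≟ w) + length (fibre U w)) V          ≡⟨ ∑-+ (λ w → 𝟙 (φ b ≟ w)) (length ∘ fibre U) V ⟩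
    ∑ (λ w → 𝟙 (φ b ≟ w)) V + ∑ (length ∘ fibre U) V      ≡⟨ cong₂ _+_ (∑-𝟙-≟ V uV (φU⊆V (here refl)))
                                                                        (∑-length-fibre uV U (φU⊆V ∘ there)) ⟩
    suc (length U)                                        ∎
    where
    open ≡-Reasoning
    fibre-∷ : ∀ w → length (fibre (b ∷ U) w) ≡ 𝟙 (φ b ≟ w) + length (fibre U w)
    fibre-∷ w with φ b ≟ w
    ... | yes _ = refl
    ... | no _  = refl

  ∑-excess-image : (U : List Y) → ∑ (excess U) (image U) + length (image U) ≡ length U
  ∑-excess-image U = begin
    ∑ (excess U) (image U) + length (image U)              ≡⟨ cong (∑ (excess U) (image U) +_) (∑-one (image U)) ⟨
    ∑ (excess U) (image U) + ∑ (λ _ → 1) (image U)         ≡⟨ ∑-+ (excess U) (λ _ → 1) (image U) ⟨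
    ∑ (λ w → excess U w + 1) (image U)                     ≡⟨ ∑-cong-∈ (image U) excess+1 ⟩
    ∑ (length ∘ fibre U) (image U)                         ≡⟨ ∑-length-fibre (image-! U) U ∈-image⁺ ⟩
    length U                                               ∎
    where
    open ≡-Reasoning
    excess+1 : ∀ {w} → w ∈ image U → excess U w + 1 ≡ length (fibre U w)
    excess+1 w∈ with ∈-map⁻ φ (∈-deduplicate⁻ _≟_ (map φ U) w∈)
    ... | b , b∈U , refl with fibre U (φ b) | ∈-filter⁺ (λ b′ → φ b′ ≟ φ b) b∈U refl
    ...   | _ ∷ bs | _ = +-comm (length bs) 1

  ∑-excess≤∑-excess-image : (U : List Y) {V : List Y} → Unique V → ∑ (excess U) V ≤ ∑ (excess U) (image U)
  ∑-excess≤∑-excess-image U uV = ∑-mono-support (excess U) (image U) uV (λ {w} _ → outside (fibre U w) (∈-filter⁻ _))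
    where
    outside : ∀ {w} (bs : List Y) → (∀ {b} → b ∈ bs → b ∈ U × φ b ≡ w) → length bs ∸ 1 ≡ 0 ⊎ w ∈ image U
    outside [] _ = inj₁ refl
    outside (b ∷ bs) bs⊆ with bs⊆ (here refl)
    ... | b∈U , refl = inj₂ (∈-image⁺ b∈U)

  -- Over the image the excesses sum to |U| − |image U|, and the image contains every b with ¬ P b.
  ∑-excess≤ : {P : Pred Y 0ℓ} (P? : Decidable P) {U V : List Y} → Unique U → Unique V →
              (∀ {b} → b ∈ U → ¬ P b → b ∈ map φ U) → ∑ (excess U) V ≤ length (filter P? U)
  ∑-excess≤ P? {U} {V} uU uV reached = +-cancelʳ-≤ (length (filter (∁? P?) U)) _ _ (begin
    ∑ (excess U) V + length (filter (∁? P?) U)            ≤⟨ +-mono-≤ (∑-excess≤∑-excess-image U uV) ∁P≤image ⟩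
    ∑ (excess U) (image U) + length (image U)             ≡⟨ ∑-excess-image U ⟩
    length U                                              ≡⟨ length-filter-∁ P? U ⟩
    length (filter P? U) + length (filter (∁? P?) U)      ∎)
    where
    open ≤-Reasoning
    ∁P≤image : length (filter (∁? P?) U) ≤ length (image U)
    ∁P≤image = length-mono-⊆ (Unique.filter⁺ (∁? P?) uU) λ b∈ →
      let b∈U , ¬Pb = ∈-filter⁻ (∁? P?) b∈ in ∈-deduplicate⁺ _≟_ (reached b∈U ¬Pb)

module StringProperties {X : Set} (_≟_ : DecidableEquality X) where
  open Strings _≟_

  consRun : X → List (X × ℕ) → List (X × ℕ)
  consRun x [] = (x , 1) ∷ []
  consRun x ((y , k) ∷ rs) with x ≟ y
  ... | yes _ = (y , suc k) ∷ rs
  ... | no _  = (x , 1) ∷ (y , k) ∷ rs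

  rle-∷ : (x : X) (xs : List X) → rle (x ∷ xs) ≡ consRun x (rle xs)
  rle-∷ x xs with rle xs
  ... | [] = refl
  ... | (y , k) ∷ rs with x ≟ y
  ...   | yes _ = refl
  ...   | no _  = refl

  rle-∷-head : (x : X) (xs : List X) → Σ ℕ λ k → Σ (List (X × ℕ)) λ rs → rle (x ∷ xs) ≡ (x , suc k) ∷ rs
  rle-∷-head x xs rewrite rle-∷ x xs with rle xs
  ... | [] = 0 , [] , refl
  ... | (y , k) ∷ rs with x ≟ y
  ...   | yes refl = k , rs , refl
  ...   | no _     = 0 , (y , k) ∷ rs , refl

  consRun-++ : (x : X) (rs qs : List (X × ℕ)) → rs ≢ [] → consRun x (rs ++ qs) ≡ consRun x rs ++ qs
  consRun-++ x [] qs rs≢[] = ⊥-elim (rs≢[] refl)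
  consRun-++ x ((y , k) ∷ rs) qs _ with x ≟ y
  ... | yes _ = refl
  ... | no _  = refl

  rle-∷≢[] : (x : X) (xs : List X) → rle (x ∷ xs) ≢ []
  rle-∷≢[] x xs eq with rle-∷-head x xs
  ... | _ , _ , eq′ with () ← trans (sym eq) eq′

  unrle-consRun : (x : X) (rs : List (X × ℕ)) → unrle (consRun x rs) ≡ x ∷ unrle rs
  unrle-consRun x [] = refl
  unrle-consRun x ((y , k) ∷ rs) with x ≟ y
  ... | yes refl = refl
  ... | no _     = refl

  unrle-rle : (xs : List X) → unrle (rle xs) ≡ xs
  unrle-rle [] = refl
  unrle-rle (x ∷ xs) = begin
    unrle (rle (x ∷ xs))         ≡⟨ cong unrle (rle-∷ x xs) ⟩
    unrle (consRun x (rle xs))   ≡⟨ unrle-consRun x (rle xs) ⟩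
    x ∷ unrle (rle xs)           ≡⟨ cong (x ∷_) (unrle-rle xs) ⟩
    x ∷ xs                       ∎
    where open ≡-Reasoning

  unrle-++ : (rs qs : List (X × ℕ)) → unrle (rs ++ qs) ≡ unrle rs ++ unrle qs
  unrle-++ [] qs = refl
  unrle-++ ((x , k) ∷ rs) qs = trans (cong (replicate k x ++_) (unrle-++ rs qs)) (sym (++-assoc (replicate k x) _ _))

  Separated : List X → List X → Set
  Separated xs ys = ∀ {a b} → last xs ≡ just a → head ys ≡ just b → a ≢ b

  rle-++ : (xs ys : List X) → Separated xs ys → rle (xs ++ ys) ≡ rle xs ++ rle ys
  rle-++ [] ys sep = refl
  rle-++ (x ∷ []) [] sep = refl
  rle-++ (x ∷ []) (y ∷ ys) sep with rle-∷-head y ys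
  ... | k , rs , eq rewrite rle-∷ x (y ∷ ys) | eq with x ≟ y
  ...   | yes x≡y = ⊥-elim (sep refl refl x≡y)
  ...   | no _    = refl
  rle-++ (x ∷ xs@(x′ ∷ xs′)) ys sep = begin
    rle (x ∷ xs ++ ys)                  ≡⟨ rle-∷ x (xs ++ ys) ⟩
    consRun x (rle (xs ++ ys))          ≡⟨ cong (consRun x) (rle-++ xs ys sep) ⟩
    consRun x (rle xs ++ rle ys)        ≡⟨ consRun-++ x (rle xs) (rle ys) (rle-∷≢[] x′ xs′) ⟩
    consRun x (rle xs) ++ rle ys        ≡⟨ cong (_++ rle ys) (rle-∷ x xs) ⟨
    rle (x ∷ xs) ++ rle ys              ∎
    where open ≡-Reasoning

  rle-replicate : (x : X) (k : ℕ) → rle (replicate (suc k) x) ≡ (x , suc k) ∷ []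
  rle-replicate x zero = refl
  rle-replicate x (suc k) rewrite rle-∷ x (replicate (suc k) x) | rle-replicate x k with x ≟ x
  ... | yes _  = refl
  ... | no x≢x = ⊥-elim (x≢x refl)

  dropLast-∷ʳ : {Y : Set} (ys : List Y) (y : Y) → dropLast (ys ++ y ∷ []) ≡ ys
  dropLast-∷ʳ []           y = refl
  dropLast-∷ʳ (_ ∷ [])     y = refl
  dropLast-∷ʳ (z ∷ z′ ∷ ys) y = cong (z ∷_) (dropLast-∷ʳ (z′ ∷ ys) y)

  shortenLast-∷ʳ : (rs : List (X × ℕ)) (y : X) (k : ℕ) → shortenLast (rs ++ (y , k) ∷ []) ≡ rs ++ (y , 1) ∷ []
  shortenLast-∷ʳ []           y k = refl
  shortenLast-∷ʳ (_ ∷ [])     y k = refl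
  shortenLast-∷ʳ (r ∷ r′ ∷ rs) y k = cong (r ∷_) (shortenLast-∷ʳ (r′ ∷ rs) y k)

  last-replicate : (x : X) (k : ℕ) → last (replicate (suc k) x) ≡ just x
  last-replicate x zero    = refl
  last-replicate x (suc k) = last-replicate x k

  last-∷ : (x : X) (xs : List X) {a : X} → last xs ≡ just a → last (x ∷ xs) ≡ just a
  last-∷ x (_ ∷ _) eq = eq

  head-++-∷ : (xs : List X) (y : X) (zs : List X) → head (xs ++ y ∷ zs) ≡ head (xs ++ y ∷ [])
  head-++-∷ []      y zs = refl
  head-++-∷ (_ ∷ _) y zs = refl

  FirstTwoDiffer-head : (x : X) (xs : List X) {b : X} → FirstTwoDiffer (x ∷ xs) → head xs ≡ just b → x ≢ b
  FirstTwoDiffer-head x (b ∷ _) x≢b refl = x≢b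

  LastTwoDiffer-last : (xs : List X) (y : X) {a : X} → LastTwoDiffer (xs ++ y ∷ []) → last xs ≡ just a → a ≢ y
  LastTwoDiffer-last (x ∷ [])          y x≢y       refl = x≢y
  LastTwoDiffer-last (x ∷ x′ ∷ [])     y ltd       eq   = LastTwoDiffer-last (x′ ∷ []) y ltd eq
  LastTwoDiffer-last (x ∷ x′ ∷ x″ ∷ xs) y ltd      eq   = LastTwoDiffer-last (x′ ∷ x″ ∷ xs) y ltd eq

  replicate-++-∷ : (x : X) (k : ℕ) (zs : List X) → replicate k x ++ x ∷ zs ≡ x ∷ replicate k x ++ zs
  replicate-++-∷ x zero    zs = refl
  replicate-++-∷ x (suc k) zs = cong (x ∷_) (replicate-++-∷ x k zs)

  LastTwoDiffer-++ : (zs w : List X) → LastTwoDiffer w → LastTwoDiffer (zs ++ w)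
  LastTwoDiffer-++ []       w ltd = ltd
  LastTwoDiffer-++ (z ∷ zs) w ltd = ∷-ltd (zs ++ w) (LastTwoDiffer-++ zs w ltd)
    where
    ∷-ltd : (v : List X) → LastTwoDiffer v → LastTwoDiffer (z ∷ v)
    ∷-ltd (_ ∷ _ ∷ [])     ltd = ltd
    ∷-ltd (_ ∷ _ ∷ _ ∷ _) ltd = ltd

  LastTwoDiffer-replicate : (y : X) (q : ℕ) {d : X} → y ≢ d → LastTwoDiffer (replicate (suc q) y ++ d ∷ [])
  LastTwoDiffer-replicate y zero    y≢d = y≢d
  LastTwoDiffer-replicate y (suc q) y≢d =
    LastTwoDiffer-++ (y ∷ []) (replicate (suc q) y ++ _ ∷ []) (LastTwoDiffer-replicate y q y≢d)

  module Extension {c x y d : X} (p q : ℕ) (mid : List X) (c≢x : c ≢ x) (y≢d : y ≢ d)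
           (ftd : FirstTwoDiffer (x ∷ mid ++ y ∷ [])) (ltd : LastTwoDiffer (x ∷ mid ++ y ∷ [])) where

    extension : List X
    extension = c ∷ replicate (suc p) x ++ mid ++ replicate (suc q) y ++ d ∷ []

    rle-extension : rle extension ≡ (c , 1) ∷ (x , suc p) ∷ rle mid ++ (y , suc q) ∷ (d , 1) ∷ []
    rle-extension = begin
      rle (c ∷ xs ++ mid ++ ys ++ d ∷ [])
        ≡⟨ rle-++ (c ∷ []) (xs ++ mid ++ ys ++ d ∷ []) (λ { refl refl → c≢x }) ⟩
      (c , 1) ∷ rle (xs ++ mid ++ ys ++ d ∷ [])
        ≡⟨ cong ((c , 1) ∷_) (rle-++ xs (mid ++ ys ++ d ∷ []) sep-x) ⟩
      (c , 1) ∷ rle xs ++ rle (mid ++ ys ++ d ∷ [])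
        ≡⟨ cong (λ r → (c , 1) ∷ rle xs ++ r) (rle-++ mid (ys ++ d ∷ []) sep-y) ⟩
      (c , 1) ∷ rle xs ++ rle mid ++ rle (ys ++ d ∷ [])
        ≡⟨ cong (λ r → (c , 1) ∷ rle xs ++ rle mid ++ r) (rle-++ ys (d ∷ []) sep-d) ⟩
      (c , 1) ∷ rle xs ++ rle mid ++ rle ys ++ (d , 1) ∷ []
        ≡⟨ cong₂ (λ r r′ → (c , 1) ∷ r ++ rle mid ++ r′ ++ (d , 1) ∷ []) (rle-replicate x p) (rle-replicate y q) ⟩
      (c , 1) ∷ (x , suc p) ∷ rle mid ++ (y , suc q) ∷ (d , 1) ∷ [] ∎
      where
      open ≡-Reasoning
      xs = replicate (suc p) x
      ys = replicate (suc q) y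
      sep-x : Separated xs (mid ++ ys ++ d ∷ [])
      sep-x ea eb rewrite last-replicate x p | head-++-∷ mid y (replicate q y ++ d ∷ []) with ea
      ... | refl = FirstTwoDiffer-head x (mid ++ y ∷ []) ftd eb
      sep-y : Separated mid (ys ++ d ∷ [])
      sep-y ea refl = LastTwoDiffer-last (x ∷ mid) y ltd (last-∷ x mid ea)
      sep-d : Separated ys (d ∷ [])
      sep-d ea refl rewrite last-replicate y q with ea
      ... | refl = y≢d

    3≤R-extension : 3 ≤ R extension
    3≤R-extension = subst (λ rs → 3 ≤ length rs) (sym rle-extension)
                          (s≤s (s≤s (≤-trans (s≤s z≤n) (length-++-≤ʳ ((y , suc q) ∷ (d , 1) ∷ []) {rle mid}))))

    w⁽¹⁾-extension : w⁽¹⁾ extension ≡ x ∷ mid ++ y ∷ []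
    w⁽¹⁾-extension with 3 ≤? R extension
    ... | no 3≰R = ⊥-elim (3≰R 3≤R-extension)
    ... | yes _ = begin
      unrle (shortenEnds (dropLast (drop 1 (rle extension))))
        ≡⟨ cong (λ rs → unrle (shortenEnds (dropLast (drop 1 rs)))) rle-extension ⟩
      unrle (shortenEnds (dropLast ((x , suc p) ∷ rle mid ++ (y , suc q) ∷ (d , 1) ∷ [])))
        ≡⟨ cong (unrle ∘ shortenEnds ∘ dropLast) (++-assoc ((x , suc p) ∷ rle mid) ((y , suc q) ∷ []) ((d , 1) ∷ [])) ⟨
      unrle (shortenEnds (dropLast (((x , suc p) ∷ rle mid ++ (y , suc q) ∷ []) ++ (d , 1) ∷ [])))
        ≡⟨ cong (unrle ∘ shortenEnds) (dropLast-∷ʳ ((x , suc p) ∷ rle mid ++ (y , suc q) ∷ []) (d , 1)) ⟩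
      unrle (shortenLast ((x , 1) ∷ rle mid ++ (y , suc q) ∷ []))
        ≡⟨ cong unrle (shortenLast-∷ʳ ((x , 1) ∷ rle mid) y (suc q)) ⟩
      x ∷ unrle (rle mid ++ (y , 1) ∷ [])
        ≡⟨ cong (x ∷_) (trans (unrle-++ (rle mid) ((y , 1) ∷ [])) (cong (_++ y ∷ []) (unrle-rle mid))) ⟩
      x ∷ mid ++ y ∷ [] ∎
      where open ≡-Reasoning

    extension-bridge : IsBridge extension
    extension-bridge = s≤s (s≤s z≤n) , c≢x ,
      LastTwoDiffer-++ (c ∷ replicate (suc p) x) (mid ++ ys) (LastTwoDiffer-++ mid ys (LastTwoDiffer-replicate y q y≢d))
      where ys = replicate (suc q) y ++ d ∷ []

    ++-extension : (P Q : List X) →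
                   (P ++ c ∷ replicate p x) ++ (x ∷ mid ++ y ∷ []) ++ (replicate q y ++ d ∷ Q) ≡ P ++ extension ++ Q
    ++-extension P Q = begin
      (P ++ c ∷ replicate p x) ++ (x ∷ mid ++ y ∷ []) ++ (replicate q y ++ d ∷ Q)
        ≡⟨ ++-assoc P (c ∷ replicate p x) _ ⟩
      P ++ c ∷ replicate p x ++ (x ∷ mid ++ y ∷ []) ++ replicate q y ++ d ∷ Q
        ≡⟨ cong (λ r → P ++ c ∷ replicate p x ++ x ∷ r) (++-assoc mid (y ∷ []) _) ⟩
      P ++ c ∷ replicate p x ++ x ∷ mid ++ y ∷ replicate q y ++ d ∷ Q
        ≡⟨ cong (λ r → P ++ c ∷ r) (replicate-++-∷ x p _) ⟩
      P ++ c ∷ replicate (suc p) x ++ mid ++ replicate (suc q) y ++ d ∷ Q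
        ≡⟨ cong (λ r → P ++ c ∷ replicate (suc p) x ++ mid ++ r) (++-assoc (replicate (suc q) y) (d ∷ []) Q) ⟨
      P ++ c ∷ replicate (suc p) x ++ mid ++ (replicate (suc q) y ++ d ∷ []) ++ Q
        ≡⟨ cong (λ r → P ++ c ∷ replicate (suc p) x ++ r) (++-assoc mid (replicate (suc q) y ++ d ∷ []) Q) ⟨
      P ++ c ∷ replicate (suc p) x ++ (mid ++ replicate (suc q) y ++ d ∷ []) ++ Q
        ≡⟨ cong (λ r → P ++ c ∷ r) (++-assoc (replicate (suc p) x) (mid ++ replicate (suc q) y ++ d ∷ []) Q) ⟨
      P ++ extension ++ Q ∎
      where open ≡-Reasoning

  changesFrom : X → List X → ℕ
  changesFrom x [] = 0
  changesFrom x (y ∷ r) with x ≟ y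
  ... | yes _ = changesFrom y r
  ... | no _  = suc (changesFrom y r)

  changes : List X → ℕ
  changes [] = 0
  changes (x ∷ r) = changesFrom x r

  R-∷ : (x : X) (xs : List X) → R (x ∷ xs) ≡ suc (changes (x ∷ xs))
  R-∷ x [] = refl
  R-∷ x (y ∷ r) with rle-∷-head y r | R-∷ y r
  ... | k , rs , eq | ih rewrite rle-∷ x (y ∷ r) | eq with x ≟ y
  ...   | yes refl = ih
  ...   | no _     = cong suc ih

  changes-∷ : (x y : X) (r : List X) → changes (y ∷ r) ≤ changes (x ∷ y ∷ r)
  changes-∷ x y r with x ≟ y
  ... | yes _ = ≤-refl
  ... | no _  = n≤1+n _

  LastTwoDiffer⇒changes>0 : (xs : List X) → LastTwoDiffer xs → 1 ≤ changes xs
  LastTwoDiffer⇒changes>0 (x ∷ y ∷ []) x≢y with x ≟ y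
  ... | yes x≡y = ⊥-elim (x≢y x≡y)
  ... | no _    = s≤s z≤n
  LastTwoDiffer⇒changes>0 (x ∷ y ∷ z ∷ zs) ltd =
    ≤-trans (LastTwoDiffer⇒changes>0 (y ∷ z ∷ zs) ltd) (changes-∷ x y (z ∷ zs))

  single-change : (y : X) (r : List X) → LastTwoDiffer (y ∷ r) → changes (y ∷ r) ≡ 1 →
                  Σ ℕ λ k → Σ X λ z → r ≡ replicate k y ++ z ∷ [] × z ≢ y
  single-change y (z ∷ r) ltd one with y ≟ z
  single-change y (z ∷ [])      y≢z one | yes y≡z = ⊥-elim (y≢z y≡z)
  single-change y (z ∷ z′ ∷ r)  ltd one | yes refl with single-change y (z′ ∷ r) ltd one
  ... | k , u , eq , u≢y = suc k , u , cong (y ∷_) eq , u≢y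
  single-change y (z ∷ [])      _   _   | no y≢z = 0 , z , refl , y≢z ∘ sym
  single-change y (z ∷ z′ ∷ r)  ltd one | no _ =
    ⊥-elim (<⇒≢ (LastTwoDiffer⇒changes>0 (z ∷ z′ ∷ r) ltd) (sym (suc-injective one)))

  R≡2-bridge : (w : List X) → IsBridge w → R w ≡ 2 → Σ X λ x → Σ X λ y → w ≡ x ∷ y ∷ []
  R≡2-bridge (x ∷ y ∷ []) _ _ = x , y , refl
  R≡2-bridge (x ∷ y ∷ z ∷ r) (_ , x≢y , ltd) R≡2 rewrite R-∷ x (y ∷ z ∷ r) with x ≟ y
  ... | yes x≡y = ⊥-elim (x≢y x≡y)
  ... | no _    = ⊥-elim (<⇒≢ (LastTwoDiffer⇒changes>0 (y ∷ z ∷ r) ltd) (sym (suc-injective (suc-injective R≡2))))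

  R≡3-bridge : (w : List X) → IsBridge w → R w ≡ 3 →
               Σ X λ x → Σ X λ y → Σ ℕ λ k → Σ X λ z → w ≡ x ∷ y ∷ replicate k y ++ z ∷ [] × z ≢ y
  R≡3-bridge (x ∷ y ∷ r) (_ , x≢y , ltd) R≡3 rewrite R-∷ x (y ∷ r) with x ≟ y
  ... | yes x≡y = ⊥-elim (x≢y x≡y)
  R≡3-bridge (x ∷ y ∷ [])    _ () | no _
  R≡3-bridge (x ∷ y ∷ z ∷ r) (_ , _ , ltd) R≡3 | no _
    with single-change y (z ∷ r) ltd (suc-injective (suc-injective R≡3))
  ... | k , u , eq , u≢y = x , y , k , u , cong (λ t → x ∷ y ∷ t) eq , u≢y

  ∈-inits⁺ : (xs ys : List X) → xs ∈ inits (xs ++ ys)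
  ∈-inits⁺ []       ys = here refl
  ∈-inits⁺ (x ∷ xs) ys = there (∈-map⁺ (x ∷_) (∈-inits⁺ xs ys))

  ∈-inits⁻ : (t : List X) {xs : List X} → xs ∈ inits t → Σ (List X) λ ys → t ≡ xs ++ ys
  ∈-inits⁻ t       (here refl) = t , refl
  ∈-inits⁻ (x ∷ t) (there xs∈) with ∈-map⁻ (x ∷_) {xs = inits t} xs∈
  ... | xs , xs∈′ , refl with ∈-inits⁻ t xs∈′
  ...   | ys , refl = ys , refl

  ∈-tails⁺ : (xs ys : List X) → ys ∈ tails (xs ++ ys)
  ∈-tails⁺ []       ys = here refl
  ∈-tails⁺ (x ∷ xs) ys = there (∈-tails⁺ xs ys)

  Occurs : List X → List X → Set
  Occurs b t = Σ (List X) λ P → Σ (List X) λ Q → t ≡ P ++ b ++ Q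

  ∈-substrings⁻ : (t : List X) {b : List X} → b ∈ substrings t → Occurs b t
  ∈-substrings⁻ [] (here refl) = [] , [] , refl
  ∈-substrings⁻ (x ∷ t) b∈ with ∈-++⁻ (inits (x ∷ t)) b∈
  ... | inj₁ b∈inits with ∈-inits⁻ (x ∷ t) b∈inits
  ...   | Q , eq = [] , Q , eq
  ∈-substrings⁻ (x ∷ t) b∈ | inj₂ b∈rest with ∈-substrings⁻ t b∈rest
  ... | P , Q , eq = x ∷ P , Q , cong (x ∷_) eq

  ∈-substrings⁺ : (P b Q : List X) → b ∈ substrings (P ++ b ++ Q)
  ∈-substrings⁺ []      b Q = ∈-++⁺ˡ (∈-inits⁺ b Q)
  ∈-substrings⁺ (x ∷ P) b Q = ∈-++⁺ʳ (inits (x ∷ P ++ b ++ Q)) (∈-substrings⁺ P b Q)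

  ∈-ℬ⁻ : (t : List X) {b : List X} → b ∈ ℬ t → IsBridge b × Occurs b t
  ∈-ℬ⁻ t b∈ with ∈-filter⁻ isBridge? (∈-deduplicate⁻ _≟ˡ_ (filter isBridge? (substrings t)) b∈)
  ... | b∈subs , bridge = bridge , ∈-substrings⁻ t b∈subs

  ∈-ℬ⁺ : (P b Q : List X) → IsBridge b → b ∈ ℬ (P ++ b ++ Q)
  ∈-ℬ⁺ P b Q bridge = ∈-deduplicate⁺ _≟ˡ_ (∈-filter⁺ isBridge? (∈-substrings⁺ P b Q) bridge)

  boundarySuffixes : List X → List (List X)
  boundarySuffixes t = filter firstTwoDiffer? (tails t)

  length-boundarySuffixes : (x : X) (r : List X) → length (boundarySuffixes (x ∷ r)) ≤ changes (x ∷ r)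
  length-boundarySuffixes x []      = z≤n
  length-boundarySuffixes x (y ∷ r) with x ≟ y
  ... | yes _ = length-boundarySuffixes y r
  ... | no _  = s≤s (length-boundarySuffixes y r)

  ∈-boundarySuffixes⁺ : (P s : List X) → FirstTwoDiffer s → s ∈ boundarySuffixes (P ++ s)
  ∈-boundarySuffixes⁺ P s ftd = ∈-filter⁺ firstTwoDiffer? (∈-tails⁺ P s) ftd

  -- the prefix of t that ends with the first two characters of its suffix s
  prefixThrough : List X → List X → List X
  prefixThrough t s = take (length t ∸ length s + 2) t

  take-length-++ : (xs ys : List X) → take (length xs) (xs ++ ys) ≡ xs
  take-length-++ []       ys = refl
  take-length-++ (x ∷ xs) ys = cong (x ∷_) (take-length-++ xs ys)

  LastTwoDiffer-split : (b : List X) → LastTwoDiffer b →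
                        Σ (List X) λ b₀ → Σ X λ a → Σ X λ z → b ≡ b₀ ++ a ∷ z ∷ [] × a ≢ z
  LastTwoDiffer-split (x ∷ y ∷ [])     x≢y = [] , x , y , refl , x≢y
  LastTwoDiffer-split (x ∷ y ∷ z ∷ zs) ltd with LastTwoDiffer-split (y ∷ z ∷ zs) ltd
  ... | b₀ , a , u , eq , a≢u = x ∷ b₀ , a , u , cong (x ∷_) eq , a≢u

  ∈-prefixesThroughBoundaries⁺ : (b Q : List X) → LastTwoDiffer b →
                                 b ∈ map (prefixThrough (b ++ Q)) (boundarySuffixes (b ++ Q))
  ∈-prefixesThroughBoundaries⁺ b Q ltd with LastTwoDiffer-split b ltd
  ... | b₀ , a , z , refl , a≢z =
    subst (_∈ map (prefixThrough t) (boundarySuffixes t)) prefix≡b (∈-map⁺ (prefixThrough t) s∈)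
    where
    open ≡-Reasoning
    s = a ∷ z ∷ Q
    t = (b₀ ++ a ∷ z ∷ []) ++ Q
    t≡ : t ≡ b₀ ++ s
    t≡ = ++-assoc b₀ (a ∷ z ∷ []) Q
    s∈ : s ∈ boundarySuffixes t
    s∈ = subst (λ t′ → s ∈ boundarySuffixes t′) (sym t≡) (∈-boundarySuffixes⁺ b₀ s a≢z)
    prefix≡b : prefixThrough t s ≡ b₀ ++ a ∷ z ∷ []
    prefix≡b = begin
      take (length t ∸ length s + 2) t              ≡⟨ cong (λ n → take (n ∸ length s + 2) t) (trans (cong length t≡) (length-++ b₀)) ⟩
      take (length b₀ + length s ∸ length s + 2) t  ≡⟨ cong (λ n → take (n + 2) t) (m+n∸n≡m (length b₀) (length s)) ⟩
      take (length b₀ + 2) t                        ≡⟨ cong (λ n → take n t) (length-++ b₀) ⟨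
      take (length (b₀ ++ a ∷ z ∷ [])) t            ≡⟨ take-length-++ (b₀ ++ a ∷ z ∷ []) Q ⟩
      b₀ ++ a ∷ z ∷ []                              ∎

  restOfRun : X → List X → List X
  restOfRun y [] = []
  restOfRun y (z ∷ r) with z ≟ y
  ... | yes _ = z ∷ restOfRun y r
  ... | no _  = z ∷ []

  -- for s = x y^(k+1) z …, with z ≠ y, this is x y^(k+1) z
  threeRunPrefix : List X → List X
  threeRunPrefix (x ∷ y ∷ r) = x ∷ y ∷ restOfRun y r
  threeRunPrefix _           = []

  restOfRun-replicate : (y z : X) (k : ℕ) (Q : List X) → z ≢ y →
                        restOfRun y (replicate k y ++ z ∷ Q) ≡ replicate k y ++ z ∷ []
  restOfRun-replicate y z zero Q z≢y with z ≟ y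
  ... | yes z≡y = ⊥-elim (z≢y z≡y)
  ... | no _    = refl
  restOfRun-replicate y z (suc k) Q z≢y with y ≟ y
  ... | yes _  = cong (y ∷_) (restOfRun-replicate y z k Q z≢y)
  ... | no y≢y = ⊥-elim (y≢y refl)

  R≡2-bridge-∈ : {b t : List X} → IsBridge b → Occurs b t → R b ≡ 2 → b ∈ map (take 2) (boundarySuffixes t)
  R≡2-bridge-∈ {b} bridge@(_ , ftd , _) (P , Q , refl) R≡2 with R≡2-bridge b bridge R≡2
  ... | x , y , refl = ∈-map⁺ (take 2) (∈-boundarySuffixes⁺ P (x ∷ y ∷ Q) ftd)

  R≡3-bridge-∈ : {b t : List X} → IsBridge b → Occurs b t → R b ≡ 3 → b ∈ map threeRunPrefix (boundarySuffixes t)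
  R≡3-bridge-∈ {b} bridge@(_ , ftd , _) (P , Q , refl) R≡3 with R≡3-bridge b bridge R≡3
  ... | x , y , k , z , refl , z≢y = subst (_∈ map threeRunPrefix (boundarySuffixes (P ++ s))) prefix≡b
                                              (∈-map⁺ threeRunPrefix (∈-boundarySuffixes⁺ P s ftd))
    where
    s = x ∷ y ∷ (replicate k y ++ z ∷ []) ++ Q
    prefix≡b : threeRunPrefix s ≡ x ∷ y ∷ replicate k y ++ z ∷ []
    prefix≡b = cong (λ r → x ∷ y ∷ r) (trans (cong (restOfRun y) (++-assoc (replicate k y) (z ∷ []) Q))
                                              (restOfRun-replicate y z k Q z≢y))

  splitTrailingRun : (x : X) (P : List X) →
    (Σ ℕ λ k → P ≡ replicate k x) ⊎ (Σ (List X) λ P′ → Σ X λ c → Σ ℕ λ k → P ≡ P′ ++ c ∷ replicate k x × c ≢ x)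
  splitTrailingRun x [] = inj₁ (0 , refl)
  splitTrailingRun x (a ∷ P) with splitTrailingRun x P
  ... | inj₂ (P′ , c , k , refl , c≢x) = inj₂ (a ∷ P′ , c , k , refl , c≢x)
  ... | inj₁ (k , refl) with a ≟ x
  ...   | yes refl = inj₁ (suc k , refl)
  ...   | no a≢x   = inj₂ ([] , a , k , refl , a≢x)

  splitLeadingRun : (y : X) (Q : List X) →
    (Σ ℕ λ k → Q ≡ replicate k y) ⊎ (Σ ℕ λ k → Σ X λ d → Σ (List X) λ Q′ → Q ≡ replicate k y ++ d ∷ Q′ × d ≢ y)
  splitLeadingRun y [] = inj₁ (0 , refl)
  splitLeadingRun y (a ∷ Q) with a ≟ y
  ... | no a≢y = inj₂ (0 , a , Q , refl , a≢y)
  ... | yes refl with splitLeadingRun y Q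
  ...   | inj₁ (k , refl)                = inj₁ (suc k , refl)
  ...   | inj₂ (k , d , Q′ , refl , d≢y) = inj₂ (suc k , d , Q′ , refl , d≢y)

  last-++-∷ : (xs : List X) (y : X) (ys : List X) → last (xs ++ y ∷ ys) ≡ last (y ∷ ys)
  last-++-∷ []            y ys = refl
  last-++-∷ (x ∷ [])      y ys = refl
  last-++-∷ (x ∷ x′ ∷ xs) y ys = last-++-∷ (x′ ∷ xs) y ys

  bridge-ends : (b : List X) → IsBridge b → Σ X λ x → Σ (List X) λ mid → Σ X λ y → b ≡ x ∷ mid ++ y ∷ []
  bridge-ends (x ∷ r) (len , _) with initLast r
  ... | []         = ⊥-elim (<-irrefl refl len)
  ... | mid ∷ʳ′ y  = x , mid , y , refl

  -- Extending the runs of x and y outwards, which is possible as long as they do not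
  -- reach the ends of t, gives a bridge of t whose w⁽¹⁾ is b.
  ∈-map-w⁽¹⁾ : (t : List X) {b : List X} → b ∈ ℬ t → head t ≢ head b → last t ≢ last b → b ∈ map w⁽¹⁾ (ℬ t)
  ∈-map-w⁽¹⁾ t {b} b∈ head≢ last≢ with ∈-ℬ⁻ t b∈
  ... | bridge@(_ , ftd , ltd) , P , Q , refl with bridge-ends b bridge
  ... | x , mid , y , refl with splitTrailingRun x P | splitLeadingRun y Q
  ... | inj₁ (k , refl) | _ = ⊥-elim (head≢ (cong head (replicate-++-∷ x k _)))
  ... | inj₂ _ | inj₁ (k , refl) = ⊥-elim (last≢ (begin
    last (P ++ (x ∷ mid ++ y ∷ []) ++ replicate k y)    ≡⟨ last-++-∷ P x _ ⟩
    last (x ∷ (mid ++ y ∷ []) ++ replicate k y)         ≡⟨ cong (λ r → last (x ∷ r)) (++-assoc mid (y ∷ []) _) ⟩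
    last (x ∷ mid ++ y ∷ replicate k y)                 ≡⟨ last-++-∷ (x ∷ mid) y _ ⟩
    last (replicate (suc k) y)                          ≡⟨ last-replicate y k ⟩
    just y                                              ≡⟨ last-++-∷ (x ∷ mid) y [] ⟨
    last (x ∷ mid ++ y ∷ [])                            ∎))
    where open ≡-Reasoning
  ... | inj₂ (P′ , c , p , refl , c≢x) | inj₂ (q , d , Q′ , refl , d≢y) =
    subst (_∈ map w⁽¹⁾ (ℬ t′)) w⁽¹⁾-extension
          (∈-map⁺ w⁽¹⁾ (subst (λ t → extension ∈ ℬ t) (sym (++-extension P′ Q′)) (∈-ℬ⁺ P′ extension Q′ extension-bridge)))
    where
    open Extension p q mid c≢x (d≢y ∘ sym) ftd ltd
    t′ = (P′ ++ c ∷ replicate p x) ++ (x ∷ mid ++ y ∷ []) ++ replicate q y ++ d ∷ Q′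

module TextBridges {A : Set} (_≟A_ : DecidableEquality A) (s : A) (S′ : List A) where

  _≟$_ : DecidableEquality (Maybe A)
  _≟$_ = Maybe.≡-dec _≟A_

  open Strings _≟$_
  open StringProperties _≟$_
  open Fibres _≟ˡ_ w⁽¹⁾
  open WithDecidableEquality _≟ˡ_
  open import Data.List.Membership.DecPropositional _≟ˡ_ using (_∈?_)
  private module OnΣ = StringProperties _≟A_

  pattern $ = nothing

  T : List (Maybe A)
  T = $T$ (s ∷ S′)

  m : ℕ
  m = Strings.R _≟A_ (s ∷ S′)

  m>0 : 1 ≤ m
  m>0 = subst (1 ≤_) (sym (OnΣ.R-∷ s S′)) (s≤s z≤n)

  changesFrom-just : (a : A) (as : List A) → changesFrom (just a) (map just as ++ $ ∷ []) ≡ suc (OnΣ.changesFrom a as)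
  changesFrom-just a []        = refl
  changesFrom-just a (a′ ∷ as) with a ≟A a′
  ... | yes refl = changesFrom-just a′ as
  ... | no _     = cong suc (changesFrom-just a′ as)

  changes-T : changes T ≡ suc m
  changes-T = cong suc (trans (changesFrom-just s S′) (sym (OnΣ.R-∷ s S′)))

  boundaries : List (List (Maybe A))
  boundaries = boundarySuffixes T

  length-boundaries : length boundaries ≤ suc m
  length-boundaries = subst (length boundaries ≤_) changes-T (length-boundarySuffixes $ (map just (s ∷ S′) ++ $ ∷ []))

  last-T : last T ≡ just $
  last-T = last-++-∷ ($ ∷ map just (s ∷ S′)) $ []

  $-at-ends : (P Q : List (Maybe A)) → T ≡ P ++ $ ∷ Q → P ≡ [] ⊎ Q ≡ []
  $-at-ends []      Q _  = inj₁ refl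
  $-at-ends (_ ∷ P) Q eq = inj₂ (no-inner-$ (s ∷ S′) P (proj₂ (∷-injective eq)))
    where
    no-inner-$ : (S : List A) (P : List (Maybe A)) → map just S ++ $ ∷ [] ≡ P ++ $ ∷ Q → Q ≡ []
    no-inner-$ []      []           refl = refl
    no-inner-$ []      (_ ∷ [])     ()
    no-inner-$ []      (_ ∷ _ ∷ _)  ()
    no-inner-$ (_ ∷ S) []           ()
    no-inner-$ (_ ∷ S) (_ ∷ P)      eq = no-inner-$ S P (proj₂ (∷-injective eq))

  ¬bridge-[_] : (x : Maybe A) → ¬ IsBridge (x ∷ [])
  ¬bridge-[ x ] (s≤s () , _)

  U : List (List (Maybe A))
  U = ℬ T

  U-! : Unique U
  U-! = deduplicate-! _≟ˡ_ (filter isBridge? (substrings T))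

  EndsWith$ : List (Maybe A) → Set
  EndsWith$ b = head b ≡ just $ ⊎ last b ≡ just $

  endsWith$? : Decidable EndsWith$
  endsWith$? b = Maybe.≡-dec _≟$_ (head b) (just $) ⊎-dec Maybe.≡-dec _≟$_ (last b) (just $)

  $-first-bridge-∈ : {b′ : List (Maybe A)} → ($ ∷ b′) ∈ U → ($ ∷ b′) ∈ map (prefixThrough T) boundaries
  $-first-bridge-∈ {b′} b∈ with ∈-ℬ⁻ T b∈
  ... | bridge@(_ , _ , ltd) , P , Q , T≡ with $-at-ends P (b′ ++ Q) T≡
  ...   | inj₁ refl = subst (λ t → ($ ∷ b′) ∈ map (prefixThrough t) (boundarySuffixes t)) (sym T≡)
                            (∈-prefixesThroughBoundaries⁺ ($ ∷ b′) Q ltd)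
  ...   | inj₂ b′++Q≡[] with ++-conicalˡ b′ Q b′++Q≡[]
  ...     | refl = ⊥-elim (¬bridge-[ $ ] bridge)

  $-last-bridge-∈ : {b₁ : List (Maybe A)} → (b₁ ++ $ ∷ []) ∈ U → (b₁ ++ $ ∷ []) ∈ boundaries
  $-last-bridge-∈ {b₁} b∈ with ∈-ℬ⁻ T b∈
  ... | bridge@(_ , ftd , _) , P , Q , T≡ with $-at-ends (P ++ b₁) Q (trans T≡ (++-∷ʳ-++ P b₁ $ Q))
  ...   | inj₂ refl = subst (λ t → (b₁ ++ $ ∷ []) ∈ boundarySuffixes t) (sym (trans T≡ (cong (P ++_) (++-identityʳ _))))
                            (∈-boundarySuffixes⁺ P (b₁ ++ $ ∷ []) ftd)
  ...   | inj₁ P++b₁≡[] with ++-conicalʳ P b₁ P++b₁≡[]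
  ...     | refl = ⊥-elim (¬bridge-[ $ ] bridge)

  -- $ occurs only at the ends of T, so such a bridge is a prefix or a suffix of T.
  $-bridge-∈ : {b : List (Maybe A)} → b ∈ U → EndsWith$ b → b ∈ map (prefixThrough T) boundaries ++ boundaries
  $-bridge-∈ {[]}     b∈ (inj₁ ())
  $-bridge-∈ {_ ∷ b′} b∈ (inj₁ refl) = ∈-++⁺ˡ ($-first-bridge-∈ b∈)
  $-bridge-∈ {b}      b∈ (inj₂ last≡$) with initLast b
  $-bridge-∈ {b}      b∈ (inj₂ ())     | []
  $-bridge-∈ {b}      b∈ (inj₂ last≡$) | b₁ ∷ʳ′ x with Maybe.just-injective (trans (sym (last-++-∷ b₁ x [])) last≡$)
  ... | refl = ∈-++⁺ʳ (map (prefixThrough T) boundaries) ($-last-bridge-∈ b∈)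

  reached : ∀ {b} → b ∈ U → ¬ EndsWith$ b → b ∈ map w⁽¹⁾ U
  reached b∈ ¬ends = ∈-map-w⁽¹⁾ T b∈ (λ eq → ¬ends (inj₁ (sym eq))) (λ eq → ¬ends (inj₂ (trans (sym eq) last-T)))

  ∑-excess≤2*boundaries : {𝒲 : List (List (Maybe A))} → Unique 𝒲 → ∑ (excess U) 𝒲 ≤ 2 * length boundaries
  ∑-excess≤2*boundaries {𝒲} 𝒲-! = begin
    ∑ (excess U) 𝒲                  ≤⟨ ∑-excess≤ endsWith$? U-! 𝒲-! reached ⟩
    length (filter endsWith$? U)    ≤⟨ length-mono-⊆ (Unique.filter⁺ endsWith$? U-!) $-bridges⊆ ⟩
    length (prefixes ++ boundaries) ≡⟨ length-++-twice prefixes boundaries (length-map (prefixThrough T) boundaries) refl ⟩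
    2 * length boundaries           ∎
    where
    open ≤-Reasoning
    prefixes = map (prefixThrough T) boundaries
    $-bridges⊆ : filter endsWith$? U ⊆ prefixes ++ boundaries
    $-bridges⊆ b∈ = let b∈U , ends = ∈-filter⁻ endsWith$? b∈ in $-bridge-∈ b∈U ends

  InB₂∪B₃ : List (Maybe A) → Set
  InB₂∪B₃ w = w ∈ U × (R w ≡ 2 ⊎ R w ≡ 3)

  inB₂∪B₃? : Decidable InB₂∪B₃
  inB₂∪B₃? w = (w ∈? U) ×-dec ((R w ≟ℕ 2) ⊎-dec (R w ≟ℕ 3))

  length-B₂∪B₃≤2*boundaries : {𝒲 : List (List (Maybe A))} → Unique 𝒲 →
                              length (filter inB₂∪B₃? 𝒲) ≤ 2 * length boundaries
  length-B₂∪B₃≤2*boundaries {𝒲} 𝒲-! = begin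
    length (filter inB₂∪B₃? 𝒲)   ≤⟨ length-mono-⊆ (Unique.filter⁺ inB₂∪B₃? 𝒲-!) B₂∪B₃⊆ ⟩
    length (twos ++ threes)      ≡⟨ length-++-twice twos threes (length-map (take 2) boundaries)
                                                                (length-map threeRunPrefix boundaries) ⟩
    2 * length boundaries        ∎
    where
    open ≤-Reasoning
    twos   = map (take 2) boundaries
    threes = map threeRunPrefix boundaries
    B₂∪B₃⊆ : filter inB₂∪B₃? 𝒲 ⊆ twos ++ threes
    B₂∪B₃⊆ w∈ with proj₂ (∈-filter⁻ inB₂∪B₃? {xs = 𝒲} w∈)
    ... | w∈U , R≡ with ∈-ℬ⁻ T w∈U | R≡
    ...   | bridge , occ | inj₁ R≡2 = ∈-++⁺ˡ (R≡2-bridge-∈ bridge occ R≡2)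
    ...   | bridge , occ | inj₂ R≡3 = ∈-++⁺ʳ twos (R≡3-bridge-∈ bridge occ R≡3)

  length-fibre≤ : {w : List (Maybe A)} → In𝒲 T w → length (fibre U w) ≤ 2 * excess U w + 𝟙 (inB₂∪B₃? w)
  length-fibre≤ {w} w∈𝒲 with inB₂∪B₃? w | w∈𝒲
  ... | yes _    | _                = n≤2[n∸1]+1 _
  ... | no _     | _ , inj₁ 2≤|K|   = ≤-trans (n≤2[n∸1] _ 2≤|K|) (m≤m+n _ 0)
  ... | no w∉B₂₃ | _ , inj₂ w∈B₂₃   = ⊥-elim (w∉B₂₃ w∈B₂₃)

  ∑-length-K≤ : (𝒲 : List (List (Maybe A))) → Unique 𝒲 → (∀ {w} → w ∈ 𝒲 → In𝒲 T w) →
                ∑ (length ∘ K T) 𝒲 ≤ 12 * m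
  ∑-length-K≤ 𝒲 𝒲-! ⊆𝒲 = begin
    ∑ (length ∘ fibre U) 𝒲                           ≤⟨ ∑-mono-∈ 𝒲 (length-fibre≤ ∘ ⊆𝒲) ⟩
    ∑ (λ w → 2 * excess U w + 𝟙 (inB₂∪B₃? w)) 𝒲      ≡⟨ ∑-+ (λ w → 2 * excess U w) (𝟙 ∘ inB₂∪B₃?) 𝒲 ⟩
    ∑ (λ w → 2 * excess U w) 𝒲 + ∑ (𝟙 ∘ inB₂∪B₃?) 𝒲  ≡⟨ cong₂ _+_ (∑-*ˡ 2 (excess U) 𝒲) (∑-𝟙 inB₂∪B₃? 𝒲) ⟩
    2 * ∑ (excess U) 𝒲 + length (filter inB₂∪B₃? 𝒲)  ≤⟨ +-mono-≤ (*-monoʳ-≤ 2 (∑-excess≤2*boundaries 𝒲-!))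
                                                                 (length-B₂∪B₃≤2*boundaries 𝒲-!) ⟩
    2 * (2 * n) + 2 * n                              ≡⟨ trans (cong (_+ 2 * n) (sym (*-assoc 2 2 n))) (sym (*-distribʳ-+ n 4 2)) ⟩
    6 * n                                            ≤⟨ *-monoʳ-≤ 6 length-boundaries ⟩
    6 * suc m                                        ≤⟨ *-monoʳ-≤ 6 1+m≤2*m ⟩
    6 * (2 * m)                                      ≡⟨ *-assoc 6 2 m ⟨
    12 * m                                           ∎
    where
    open ≤-Reasoning
    n = length boundaries
    1+m≤2*m : suc m ≤ 2 * m
    1+m≤2*m = subst (suc m ≤_) (cong (m +_) (sym (+-identityʳ m))) (+-monoˡ-≤ m m>0)

lemma9 : Σ ℕ λ C →
    (A : Set) (_<_ : Rel A 0ℓ) (sto : IsStrictTotalOrder _≡_ _<_) →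
    (S : List A) → 1 ≤ length S →
    (𝒲 : List (List (Maybe A))) → Unique 𝒲 →
    (∀ w → (w ∈ 𝒲 → Text.In𝒲 (IsStrictTotalOrder._≟_ sto) S w)
         × (Text.In𝒲 (IsStrictTotalOrder._≟_ sto) S w → w ∈ 𝒲)) →
    sum (map (λ w → length (Text.K (IsStrictTotalOrder._≟_ sto) S w)) 𝒲)
      ≤ C * Text.m (IsStrictTotalOrder._≟_ sto) S
lemma9 = 12 , λ where
  A _<_ sto (s ∷ S′) _ 𝒲 𝒲-! 𝒲≡ →
    TextBridges.∑-length-K≤ (IsStrictTotalOrder._≟_ sto) s S′ 𝒲 𝒲-! (λ {w} → proj₁ (𝒲≡ w))
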